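{- Let $A$, $B$, $C$ be logics with $A \le B \le C$, and suppose $C$ is reducible to $A$ by a mapping $t$. Then $C$ is reducible to $B$ by the same mapping $t$.
   Context: A logic is given by inference rules on sequents; its theorems are the derivable sequents. A rule is a derived rule of a logic if it can be obtained as a combination of that logic's inference rules; $A\le B$ means every inference rule of $A$ is a derived rule of $B$ (so every theorem of $A$ is a theorem of $B$). Given logics $A$ and $L$, a sequent $\sigma$ is called $A$-compatible (in the context of $L$) if $\sigma$ is either a theorem of both $L$ and $A$ or a theorem of neither. A logic $L$ is reducible to a logic $A$ by a mapping $t$ from sequents to sequents if $t$ is theoremhood-preserving in $L$ (for every $\sigma$, $\sigma$ is a theorem of $L$ iff $t(\sigma)$ is a theorem of $L$) and every sequent $t(\sigma)$ is $A$-compatible in the context of $L$. -}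

module Defs where

open import Level using (Level; _⊔_; suc)
open import Data.List using (List)
open import Data.List.Membership.Propositional using (_∈_)
open import Data.List.Relation.Unary.All using (All)
open import Data.Product using (_×_)
open import Data.Empty using (⊥)
open import Data.Sum using (_⊎_)
open import Relation.Nullary using (¬_)

-- An inference rule over a type S of sequents: a finite list of premises
-- and a conclusion (axioms are rules with no premises).
record Rule {s : Level} (S : Set s) : Set s where
  constructor _⇒_
  field
    premises   : List S
    conclusion : S
open Rule public

Logic : ∀ {s} (ℓ : Level) → Set s → Set (s ⊔ Level.suc ℓ)
Logic ℓ S = Rule S → Set ℓ

data Derivable {s ℓ h} {S : Set s} (L : Logic ℓ S) (H : S → Set h)
       : S → Set (s ⊔ ℓ ⊔ h) where
  hyp   : ∀ {σ} → H σ → Derivable L H σ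
  apply : (r : Rule S) → L r → All (Derivable L H) (premises r)
        → Derivable L H (conclusion r)

Theorem : ∀ {s ℓ} {S : Set s} → Logic ℓ S → S → Set (s ⊔ ℓ)
Theorem {s} {ℓ} {S} L σ = Derivable {h = Level.zero} L (λ _ → ⊥) σ

DerivedRule : ∀ {s ℓ} {S : Set s} → Logic ℓ S → Rule S → Set (s ⊔ ℓ)
DerivedRule L r = Derivable L (λ σ → σ ∈ premises r) (conclusion r)

_≤L_ : ∀ {s ℓ₁ ℓ₂} {S : Set s} → Logic ℓ₁ S → Logic ℓ₂ S → Set (s ⊔ ℓ₁ ⊔ ℓ₂)
A ≤L B = ∀ r → A r → DerivedRule B r

Compatible : ∀ {s ℓ₁ ℓ₂} {S : Set s} → Logic ℓ₁ S → Logic ℓ₂ S → S → Set (s ⊔ ℓ₁ ⊔ ℓ₂)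
Compatible A L σ = (Theorem L σ × Theorem A σ) ⊎ (¬ Theorem L σ × ¬ Theorem A σ)

ReducibleBy : ∀ {s ℓ₁ ℓ₂} {S : Set s} → Logic ℓ₁ S → Logic ℓ₂ S → (S → S) → Set (s ⊔ ℓ₁ ⊔ ℓ₂)
ReducibleBy L A t =
  (∀ σ → (Theorem L σ → Theorem L (t σ)) × (Theorem L (t σ) → Theorem L σ))
  × (∀ σ → Compatible A L (t σ))

-- A ≤ B lets every derivation of A be replayed in B, each A-rule step being
-- replaced by its B-derivation with the premises grafted in, so theorems of
-- A are theorems of B and theorems of B are theorems of C. A theorem of C and
-- A is then one of B, and a non-theorem of C cannot be a theorem of B; the
-- preservation half of reducibility concerns C alone.
module Submission where

open import Defs
open import Data.List using (List; []; _∷_)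
open import Data.List.Membership.Propositional using (_∈_)
open import Data.List.Relation.Unary.All using (All; []; _∷_; lookup)
open import Data.Product using (_,_)
open import Data.Sum using (inj₁; inj₂)

module _ {s ℓ h} {S : Set s} {L : Logic ℓ S} {H : S → Set h} where

  graft : ∀ {ps : List S} → All (Derivable L H) ps →
          ∀ {σ} → Derivable L (_∈ ps) σ → Derivable L H σ
  graftAll : ∀ {ps : List S} → All (Derivable L H) ps →
             ∀ {qs} → All (Derivable L (_∈ ps)) qs → All (Derivable L H) qs
  graft ds (hyp σ∈ps)      = lookup ds σ∈ps
  graft ds (apply r Lr qs) = apply r Lr (graftAll ds qs)
  graftAll ds []       = []
  graftAll ds (q ∷ qs) = graft ds q ∷ graftAll ds qs

module _ {s ℓ₁ ℓ₂ h} {S : Set s} {A : Logic ℓ₁ S} {B : Logic ℓ₂ S} {H : S → Set h}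
         (A≤B : A ≤L B) where

  Derivable-mono : ∀ {σ} → Derivable A H σ → Derivable B H σ
  Derivable-monoAll : ∀ {qs} → All (Derivable A H) qs → All (Derivable B H) qs
  Derivable-mono (hyp Hσ)        = hyp Hσ
  Derivable-mono (apply r Ar ds) = graft (Derivable-monoAll ds) (A≤B r Ar)
  Derivable-monoAll []       = []
  Derivable-monoAll (d ∷ ds) = Derivable-mono d ∷ Derivable-monoAll ds

Theorem-mono : ∀ {s ℓ₁ ℓ₂} {S : Set s} {A : Logic ℓ₁ S} {B : Logic ℓ₂ S} →
               A ≤L B → ∀ {σ} → Theorem A σ → Theorem B σ
Theorem-mono = Derivable-mono

Compatible-between : ∀ {s ℓ₁ ℓ₂ ℓ₃} {S : Set s}
                     {A : Logic ℓ₁ S} {B : Logic ℓ₂ S} {C : Logic ℓ₃ S} →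
                     A ≤L B → B ≤L C → ∀ {σ} → Compatible A C σ → Compatible B C σ
Compatible-between A≤B B≤C (inj₁ (⊢Cσ , ⊢Aσ))  = inj₁ (⊢Cσ , Theorem-mono A≤B ⊢Aσ)
Compatible-between A≤B B≤C (inj₂ (⊬Cσ , _))    = inj₂ (⊬Cσ , λ ⊢Bσ → ⊬Cσ (Theorem-mono B≤C ⊢Bσ))

lemma2p1 : ∀ {s a b c} {S : Set s} (A : Logic a S) (B : Logic b S) (C : Logic c S)
             (t : S → S) → A ≤L B → B ≤L C → ReducibleBy C A t → ReducibleBy C B t
lemma2p1 A B C t A≤B B≤C (preserves , compatible) =
  preserves , λ σ → Compatible-between A≤B B≤C (compatible σ)
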